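{- (In $\mathsf{ZF}$.) For every $n\in\omega$ and every set $A$ with at least $2n(2^{n+1}-1)$ elements, there is an injection from $A^n$ into $\mathscr{B}_{\mathrm{fin}}(A)$.
   Context: Work in $\mathsf{ZF}$. $A^n$ is the set of functions from $n=\{0,\dots,n-1\}$ to $A$. A partition is finitary if all its blocks are finite; $\mathscr{B}(A)$ is the set of finitary partitions of $A$. For a partition $P$, $\mathrm{ns}(P)$ is the set of blocks with more than one element; $\mathscr{B}_{\mathrm{fin}}(A)=\{P\in\mathscr{B}(A)\mid\mathrm{ns}(P)\text{ finite}\}$. -}

module Defs where

open import Level using (0ℓ)
open import Data.Nat using (ℕ; _*_; _+_; _∸_; _^_)
open import Data.Fin using (Fin)
open import Data.List using (List)
open import Data.List.Membership.Propositional using (_∈_)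
open import Data.Product using (Σ; ∃; _×_)
open import Relation.Binary.PropositionalEquality using (_≡_; _≢_)
open import Relation.Binary.Structures using (IsEquivalence)
open import Relation.Nullary using (Dec)
open import Function.Bundles using (_⇔_)

-- ZF's classical logic, restricted to propositions (no choice principle).
IsProp : Set → Set
IsProp P = (x y : P) → x ≡ y

PropLEM : Set₁
PropLEM = {P : Set} → IsProp P → Dec P

Pow : Set → ℕ → Set
Pow A n = Fin n → A

_≈ₚ_ : {A : Set} {n : ℕ} → Pow A n → Pow A n → Set
x ≈ₚ y = ∀ i → x i ≡ y i

-- A partition of A, given by its equivalence relation; the blocks are the
-- equivalence classes  Block R a = { b | R a b }.
record Partition (A : Set) : Set₁ where
  field
    rel   : A → A → Set
    isEq  : IsEquivalence rel

FiniteSubset : {A : Set} → (A → Set) → Set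
FiniteSubset {A} S = Σ (List A) λ l → ∀ b → S b ⇔ (b ∈ l)

module _ {A : Set} (P : Partition A) where
  open Partition P

  Block : A → A → Set
  Block a = rel a

  NonSingleton : A → Set
  NonSingleton a = ∃ λ b → Block a b × b ≢ a

  Finitary : Set
  Finitary = ∀ a → FiniteSubset (Block a)

  -- ns(P) finite: a finite list of blocks (given by representatives)
  -- containing every non-singleton block
  NsFinite : Set
  NsFinite = Σ (List A) λ reps →
               ∀ a → NonSingleton a → ∃ λ c → c ∈ reps × (∀ b → Block a b ⇔ Block c b)

record Bfin (A : Set) : Set₁ where
  field
    part     : Partition A
    finitary : Finitary part
    nsFinite : NsFinite part

_≈B_ : {A : Set} → Bfin A → Bfin A → Set
P ≈B Q = ∀ a b → Partition.rel (Bfin.part P) a b ⇔ Partition.rel (Bfin.part Q) a b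

-- Spend, for each coordinate i, a pair of fresh points {mᵢ₀, mᵢ₁} and glue it to the value xᵢ:
-- the partition of x has the blocks {xᵢ, mᵢ₀, mᵢ₁} (merged where values coincide) and singletons
-- otherwise.  To recover x, the pair for i must avoid all values of x, so it is chosen among n + 1
-- disjoint candidate pairs, one of which misses the n values of x by pigeonhole; the chosen pair is
-- then visible in the partition (it is the only candidate whose two points are related), and xᵢ is
-- the unique non-marked point in its block.  This needs 2n(n+1) ≤ 2n(2ⁿ⁺¹ − 1) points.  The
-- construction decides equality on A, which excluded middle for propositions provides because
-- identity types are propositions (axiom K).
module Submission where

open import Defs
open import Data.Nat using (ℕ; _*_; _+_; _∸_; _^_)
open import Data.Fin using (Fin)
open import Data.Product using (Σ)
open import Function.Bundles using (_↣_)
open import Function.Definitions using (Injective)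

open import Axiom.UniquenessOfIdentityProofs.WithK using (uip)
open import Data.Empty using (⊥-elim)
open import Data.Fin as Fin using (combine; inject≤) renaming (zero to 0F; suc to 1+)
open import Data.Fin.Properties
  using (any?; all?; ¬∀⟶∃¬; pigeonhole; <⇒≢; 0≢1+n; combine-injective; inject≤-injective)
open import Data.List using (List; _∷_; filter; cartesianProductWith; allFin)
open import Data.List.Membership.Propositional using (_∈_)
open import Data.List.Membership.Propositional.Properties
  using (∈-filter⁺; ∈-filter⁻; ∈-cartesianProductWith⁺; ∈-allFin)
open import Data.List.Relation.Unary.Any using (here; there)
open import Data.Nat using (suc; zero; _≤_; _<_; s≤s; z≤n)
open import Data.Nat.Properties
  using (n<1+n; m^n>0; +-monoˡ-≤; +-identityʳ; +-comm; *-monoʳ-≤; ∸-monoˡ-≤; module ≤-Reasoning)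
open import Data.Product using (_,_; proj₁; proj₂; ∃; ∃₂; _×_)
open import Data.Sum using (_⊎_; inj₁; inj₂)
open import Function.Base using (id; _∘_)
open import Function.Bundles using (Injection; mk⇔; Equivalence; _⇔_)
open import Relation.Binary.Definitions using (DecidableEquality)
open import Relation.Binary.PropositionalEquality
open import Relation.Nullary using (yes; no; ¬_)
open import Relation.Unary using (Decidable)

n<2^n : ∀ n → n < 2 ^ n
n<2^n zero = s≤s z≤n
n<2^n (suc n) = begin-strict
  suc n              <⟨ s≤s (n<2^n n) ⟩
  1 + 2 ^ n          ≤⟨ +-monoˡ-≤ (2 ^ n) (m^n>0 2 n) ⟩
  2 ^ n + 2 ^ n      ≡⟨ cong (2 ^ n +_) (sym (+-identityʳ (2 ^ n))) ⟩
  2 ^ suc n          ∎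
  where open ≤-Reasoning

2n[1+n]≤2n[2^[n+1]∸1] : ∀ n → 2 * n * suc n ≤ 2 * n * (2 ^ (n + 1) ∸ 1)
2n[1+n]≤2n[2^[n+1]∸1] n = *-monoʳ-≤ (2 * n) (∸-monoˡ-≤ 1 2+n≤2^[n+1])
  where
  2+n≤2^[n+1] : 2 + n ≤ 2 ^ (n + 1)
  2+n≤2^[n+1] = subst (λ e → 2 + n ≤ 2 ^ e) (+-comm 1 n) (n<2^n (suc n))

combine₃-injective : ∀ {a b c} (i i′ : Fin a) (j j′ : Fin b) (k k′ : Fin c) →
  combine (combine i j) k ≡ combine (combine i′ j′) k′ → i ≡ i′ × j ≡ j′ × k ≡ k′
combine₃-injective i i′ j j′ k k′ eq
  with ij≡ij′ , k≡k′ ← combine-injective (combine i j) k (combine i′ j′) k′ eq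
  with i≡i′ , j≡j′ ← combine-injective i j i′ j′ ij≡ij′
  = i≡i′ , j≡j′ , k≡k′

module _ {A : Set} {n w : ℕ} (_≟_ : DecidableEquality A)
         (x : Fin n → A) (s : Fin (suc n) → Fin w → A)
         (s-injˡ : ∀ {k c l d} → s k c ≡ s l d → k ≡ l) where

  private
    Hit : Fin (suc n) → Set
    Hit k = ∃₂ λ j c → x j ≡ s k c

    hit? : Decidable Hit
    hit? k = any? λ j → any? λ c → x j ≟ s k c

    ¬all-hit : ¬ (∀ k → Hit k)
    ¬all-hit hits with k , l , k<l , same ← pigeonhole (n<1+n n) (λ k → proj₁ (hits k))
      = <⇒≢ k<l (s-injˡ (trans (sym (witness k)) (trans (cong x same) (witness l))))
      where
      witness : ∀ k → x (proj₁ (hits k)) ≡ s k (proj₁ (proj₂ (hits k)))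
      witness k = proj₂ (proj₂ (hits k))

  free-slot : ∃ λ k → ∀ j c → x j ≢ s k c
  free-slot with all? hit?
  ... | yes hits = ⊥-elim (¬all-hit hits)
  ... | no ¬hits with k , ¬hit ← ¬∀⟶∃¬ _ Hit hit? ¬hits = k , λ j c e → ¬hit (j , c , e)

kernelPartition : {A B : Set} → (A → B) → Partition A
kernelPartition r = record
  { rel = λ a b → r a ≡ r b
  ; isEq = record { refl = refl ; sym = sym ; trans = trans }
  }

MovesOnly : {A : Set} → (A → A) → List A → Set
MovesOnly r S = ∀ b → r b ≡ b ⊎ b ∈ S

module _ {A : Set} {r : A → A} {S : List A} (moves : MovesOnly r S) where

  kernel-finitary : DecidableEquality A → Finitary (kernelPartition r)
  kernel-finitary _≟_ a = filter related? (r a ∷ S) , λ b → mk⇔ (block⊆ b) (proj₂ ∘ ∈-filter⁻ related?)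
    where
    related? : Decidable (λ b → r a ≡ r b)
    related? b = r a ≟ r b
    block⊆ : ∀ b → r a ≡ r b → b ∈ filter related? (r a ∷ S)
    block⊆ b ra≡rb with moves b
    ... | inj₁ rb≡b = ∈-filter⁺ related? (here (trans (sym rb≡b) (sym ra≡rb))) ra≡rb
    ... | inj₂ b∈S  = ∈-filter⁺ related? (there b∈S) ra≡rb

  kernel-nsFinite : NsFinite (kernelPartition r)
  kernel-nsFinite = S , representative
    where
    representative : ∀ a → NonSingleton (kernelPartition r) a →
      ∃ λ c → c ∈ S × (∀ b → (r a ≡ r b) ⇔ (r c ≡ r b))
    representative a (b , ra≡rb , b≢a) with moves a | moves b
    ... | inj₂ a∈S  | _         = a , a∈S , λ _ → mk⇔ id id
    ... | inj₁ _    | inj₂ b∈S  = b , b∈S , λ _ → mk⇔ (trans (sym ra≡rb)) (trans ra≡rb)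
    ... | inj₁ ra≡a | inj₁ rb≡b = ⊥-elim (b≢a (trans (sym rb≡b) (trans (sym ra≡rb) ra≡a)))

kernelBfin : {A : Set} → DecidableEquality A → (r : A → A) {S : List A} → MovesOnly r S → Bfin A
kernelBfin _≟_ r moves = record
  { part = kernelPartition r
  ; finitary = kernel-finitary moves _≟_
  ; nsFinite = kernel-nsFinite moves
  }

module Collapse {A : Set} (_≟_ : DecidableEquality A) {n w : ℕ}
  (μ : Fin n → Fin w → A) (μ-injˡ : ∀ {i c j d} → μ i c ≡ μ j d → i ≡ j) (x : Fin n → A) where

  Marked : A → Set
  Marked b = ∃₂ λ i c → b ≡ μ i c

  marked? : Decidable Marked
  marked? b = any? λ i → any? λ c → b ≟ μ i c

  collapse : A → A
  collapse b with marked? b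
  ... | yes (i , _) = x i
  ... | no _        = b

  collapse-marked : ∀ i c → collapse (μ i c) ≡ x i
  collapse-marked i c with marked? (μ i c)
  ... | yes (j , d , μic≡μjd) = cong x (sym (μ-injˡ μic≡μjd))
  ... | no unmarked           = ⊥-elim (unmarked (i , c , refl))

  collapse-unmarked : ∀ {b} → ¬ Marked b → collapse b ≡ b
  collapse-unmarked {b} unmarked with marked? b
  ... | yes marked = ⊥-elim (unmarked marked)
  ... | no _       = refl

  marks : List A
  marks = cartesianProductWith μ (allFin n) (allFin w)

  collapse-movesOnly : MovesOnly collapse marks
  collapse-movesOnly b with marked? b
  ... | yes (i , c , refl) = inj₂ (∈-cartesianProductWith⁺ μ (∈-allFin i) (∈-allFin c))
  ... | no _               = inj₁ refl

module Embedding {A : Set} (_≟_ : DecidableEquality A) {n : ℕ}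
  (m : Fin n → Fin (suc n) → Fin 2 → A)
  (m-inj : ∀ {i k c j l d} → m i k c ≡ m j l d → i ≡ j × k ≡ l × c ≡ d) where

  free-slot-of : (x : Pow A n) (i : Fin n) → ∃ λ k → ∀ j c → x j ≢ m i k c
  free-slot-of x i = free-slot _≟_ x (m i) (λ eq → proj₁ (proj₂ (m-inj eq)))

  slot : Pow A n → Fin n → Fin (suc n)
  slot x i = proj₁ (free-slot-of x i)

  mark : Pow A n → Fin n → Fin 2 → A
  mark x i = m i (slot x i)

  private module Collapsing (x : Pow A n) = Collapse _≟_ (mark x) (λ eq → proj₁ (m-inj eq)) x
  open Collapsing

  embed : Pow A n → Bfin A
  embed x = kernelBfin _≟_ (collapse x) (collapse-movesOnly x)

  value-unmarked : ∀ x i → ¬ Marked x (x i)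
  value-unmarked x i (j , c , xi≡mark) = proj₂ (free-slot-of x j) i c xi≡mark

  marked⇒slot : ∀ y {i k c} → Marked y (m i k c) → k ≡ slot y i
  marked⇒slot y (j , d , eq) with refl , k≡slot , _ ← m-inj eq = k≡slot

  related⇒slot : ∀ y i k → collapse y (m i k 0F) ≡ collapse y (m i k (1+ 0F)) → k ≡ slot y i
  related⇒slot y i k related with k Fin.≟ slot y i
  ... | yes k≡slot = k≡slot
  ... | no k≢slot = ⊥-elim (0≢1+n (proj₂ (proj₂ (m-inj (begin
    m i k 0F                   ≡˘⟨ fixed 0F ⟩
    collapse y (m i k 0F)      ≡⟨ related ⟩
    collapse y (m i k (1+ 0F)) ≡⟨ fixed (1+ 0F) ⟩
    m i k (1+ 0F)              ∎)))))
    where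
    open ≡-Reasoning
    fixed : ∀ c → collapse y (m i k c) ≡ m i k c
    fixed c = collapse-unmarked y (λ marked → k≢slot (marked⇒slot y marked))

  ≈B⇒slot≡ : ∀ {x y} → embed x ≈B embed y → ∀ i → slot x i ≡ slot y i
  ≈B⇒slot≡ {x} {y} x≈y i = related⇒slot y i (slot x i) (Equivalence.to (x≈y (mark x i 0F) (mark x i (1+ 0F)))
    (trans (collapse-marked x i 0F) (sym (collapse-marked x i (1+ 0F)))))

  embed-injective : Injective (_≈ₚ_ {A} {n}) _≈B_ embed
  embed-injective {x} {y} x≈y i = begin
    x i                      ≡˘⟨ collapse-unmarked y (value-unmarked x i ∘ marked-x) ⟩
    collapse y (x i)         ≡⟨ Equivalence.to (x≈y (x i) (mark x i 0F)) x[i]~mark ⟩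
    collapse y (mark x i 0F) ≡⟨ cong (λ k → collapse y (m i k 0F)) (same-slots i) ⟩
    collapse y (mark y i 0F) ≡⟨ collapse-marked y i 0F ⟩
    y i                      ∎
    where
    open ≡-Reasoning
    same-slots : ∀ i → slot x i ≡ slot y i
    same-slots = ≈B⇒slot≡ x≈y
    marked-x : ∀ {b} → Marked y b → Marked x b
    marked-x (j , c , b≡mark) = j , c , trans b≡mark (cong (λ k → m j k c) (sym (same-slots j)))
    x[i]~mark : collapse x (x i) ≡ collapse x (mark x i 0F)
    x[i]~mark = trans (collapse-unmarked x (value-unmarked x i)) (sym (collapse-marked x i 0F))

lemma4p16 : PropLEM → (n : ℕ) → (A : Set) → Fin (2 * n * (2 ^ (n + 1) ∸ 1)) ↣ A →
    Σ (Pow A n → Bfin A) (λ f → Injective (_≈ₚ_ {A} {n}) _≈B_ f)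
lemma4p16 lem n A ι = embed , embed-injective
  where
  open Injection ι using (to; injective)
  tag : Fin n → Fin (suc n) → Fin 2 → Fin (2 * n * (2 ^ (n + 1) ∸ 1))
  tag i k c = inject≤ (combine (combine c i) k) (2n[1+n]≤2n[2^[n+1]∸1] n)
  m : Fin n → Fin (suc n) → Fin 2 → A
  m i k c = to (tag i k c)
  m-inj : ∀ {i k c j l d} → m i k c ≡ m j l d → i ≡ j × k ≡ l × c ≡ d
  m-inj {i} {k} {c} {j} {l} {d} eq
    with c≡d , i≡j , k≡l ← combine₃-injective c d i j k l (inject≤-injective _ _ _ _ (injective eq))
    = i≡j , k≡l , c≡d
  open Embedding (λ a b → lem uip) m m-inj
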